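{- A variety $\mathsf{V}$ of Heyting algebras is locally finite if and only if its subvariety $\mathsf{V}'\subseteq\mathsf{V}$ defined (relative to $\mathsf{V}$) by the equation $\neg x\lor\neg\neg x\approx\mathbf{1}$ is locally finite.
   Context: Heyting algebras are algebras $(A;\land,\lor,\to,\neg)$ with $(A;\land,\lor)$ a bounded distributive lattice, $\to$ the relative pseudocomplement and $\neg x=x\to\mathbf{0}$. A variety is locally finite if every finitely generated algebra in it is finite. -}

module Defs where

open import Level using (Level; 0ℓ; _⊔_) renaming (suc to lsuc)
open import Data.Nat using (ℕ)
open import Data.Fin using (Fin)
open import Data.Product using (Σ; _×_; _,_)
open import Data.Sum using (_⊎_)
open import Relation.Unary using (Pred)
open import Relation.Binary.PropositionalEquality using (_≡_)
open import Relation.Binary.Lattice.Bundles using (HeytingAlgebra)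

data Term (X : Set) : Set where
  var  : X → Term X
  zer  : Term X
  one  : Term X
  _∧ₜ_ : Term X → Term X → Term X
  _∨ₜ_ : Term X → Term X → Term X
  _⇒ₜ_ : Term X → Term X → Term X
  ¬ₜ_  : Term X → Term X

module _ {c ℓ₁ ℓ₂} (A : HeytingAlgebra c ℓ₁ ℓ₂) where
  open HeytingAlgebra A

  ⟦_⟧ : {X : Set} → Term X → (X → Carrier) → Carrier
  ⟦ var x ⟧  ρ = ρ x
  ⟦ zer ⟧    ρ = ⊥
  ⟦ one ⟧    ρ = ⊤
  ⟦ s ∧ₜ t ⟧ ρ = ⟦ s ⟧ ρ ∧ ⟦ t ⟧ ρ
  ⟦ s ∨ₜ t ⟧ ρ = ⟦ s ⟧ ρ ∨ ⟦ t ⟧ ρ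
  ⟦ s ⇒ₜ t ⟧ ρ = ⟦ s ⟧ ρ ⇨ ⟦ t ⟧ ρ
  ⟦ ¬ₜ s ⟧   ρ = ⟦ s ⟧ ρ ⇨ ⊥

  Finite : Set (c ⊔ ℓ₁)
  Finite = Σ ℕ λ n → Σ (Fin n → Carrier) λ f → ∀ a → Σ (Fin n) λ i → f i ≈ a

  FinitelyGenerated : Set (c ⊔ ℓ₁)
  FinitelyGenerated = Σ ℕ λ n → Σ (Fin n → Carrier) λ g →
    ∀ a → Σ (Term (Fin n)) λ t → ⟦ t ⟧ g ≈ a

Equation : Set
Equation = Term ℕ × Term ℕ

_⊨_ : ∀ {c ℓ₁ ℓ₂} → HeytingAlgebra c ℓ₁ ℓ₂ → Equation → Set (c ⊔ ℓ₁)
A ⊨ (s , t) = ∀ (ρ : ℕ → Carrier) → ⟦ A ⟧ s ρ ≈ ⟦ A ⟧ t ρ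
  where open HeytingAlgebra A

-- A variety of Heyting algebras, presented (Birkhoff) by a set E of equations:
-- its members are the Heyting algebras satisfying all equations in E.
Variety : Set₁
Variety = Pred Equation 0ℓ

_∈V_ : ∀ {c ℓ₁ ℓ₂} → HeytingAlgebra c ℓ₁ ℓ₂ → Variety → Set (c ⊔ ℓ₁)
A ∈V E = ∀ e → E e → A ⊨ e

LocallyFinite : (c ℓ₁ ℓ₂ : Level) → Variety → Set (lsuc (c ⊔ ℓ₁ ⊔ ℓ₂))
LocallyFinite c ℓ₁ ℓ₂ E = (A : HeytingAlgebra c ℓ₁ ℓ₂) → A ∈V E →
  FinitelyGenerated A → Finite A

kcEquation : Equation
kcEquation = ((¬ₜ var 0) ∨ₜ (¬ₜ (¬ₜ var 0))) , one

_′ : Variety → Variety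
(E ′) e = E e ⊎ e ≡ kcEquation

{-# OPTIONS --safe #-}
module Submission where

-- Let A ∈ V be generated by g₁ … gₙ. Its ¬¬-quotient is a Boolean homomorphic
-- image of A, so it lies in V′ and is finite. The element d = ⋀ⱼ (gⱼ ∨ ¬gⱼ) is
-- dense and lies below t ∨ ¬t for every t ∈ A. Let K be the subalgebra
-- generated by the elements d ∨ gⱼ and d ∨ r, r one of the finitely many regular
-- elements; the regular ones are what makes d ∨ (s ⇨ t) and d ∨ ¬s expressible,
-- so d ∨ t ∈ K for all t ∈ A. Every element of K is either ⊥ or above d, so K
-- satisfies ¬x ∨ ¬¬x ≈ 1; hence K ∈ V′ is finite. Finally every a ∈ A equals
-- (d ∨ a) ∧ ¬¬a, a meet of an element of K and a regular element.

open import Defs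
open import Level using (Level; _⊔_; Lift; lift; lower)
open import Function.Base using (_∘_)
open import Function.Bundles using (_⇔_; mk⇔)
open import Data.Nat.Base using (ℕ; zero; suc; _+_; _*_)
open import Data.Fin.Base using (Fin; zero; suc; splitAt; _↑ˡ_; _↑ʳ_; combine; remQuot)
open import Data.Fin.Properties using (splitAt-↑ˡ; splitAt-↑ʳ; remQuot-combine)
open import Data.Product.Base using (Σ; _,_; proj₁; proj₂; uncurry)
open import Data.Sum.Base using (_⊎_; inj₁; inj₂)
import Relation.Binary.PropositionalEquality as ≡
open import Relation.Binary.Lattice.Bundles using (HeytingAlgebra)
import Relation.Binary.Lattice.Properties.HeytingAlgebra as HeytingProperties
import Relation.Binary.Lattice.Properties.MeetSemilattice as MeetProperties
import Relation.Binary.Lattice.Properties.JoinSemilattice as JoinProperties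
import Relation.Binary.Lattice.Properties.BoundedLattice as BoundedProperties
import Relation.Binary.Lattice.Properties.DistributiveLattice as DistributiveProperties
import Relation.Binary.Reasoning.PartialOrder as ≤-Reasoning
import Relation.Binary.Reasoning.Setoid as ≈-Reasoning

module Properties {c ℓ₁ ℓ₂} (A : HeytingAlgebra c ℓ₁ ℓ₂) where
  open HeytingAlgebra A
  open HeytingProperties A public
  open MeetProperties meetSemilattice public using (∧-cong; ∧-comm; ∧-monotonic)
  open JoinProperties joinSemilattice public using (∨-cong; ∨-comm; ∨-monotonic)
  open BoundedProperties boundedLattice public using (∨-zeroʳ)
  open DistributiveProperties distributiveLattice public using (∨-distribˡ-∧)
  open ≤-Reasoning poset

  ∨-distribˡ-∨ : ∀ x y z → x ∨ (y ∨ z) ≈ (x ∨ y) ∨ (x ∨ z)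
  ∨-distribˡ-∨ x y z = antisym
    (∨-least (trans (x≤x∨y x y) (x≤x∨y _ _)) (∨-monotonic (y≤x∨y x y) (y≤x∨y x z)))
    (∨-least (∨-monotonic refl (x≤x∨y y z)) (∨-monotonic refl (y≤x∨y y z)))

  ∨-∧-elim : ∀ {x y z w} → x ∧ z ≤ w → y ∧ z ≤ w → (x ∨ y) ∧ z ≤ w
  ∨-∧-elim x∧z≤w y∧z≤w = transpose-∧ (∨-least (transpose-⇨ x∧z≤w) (transpose-⇨ y∧z≤w))

  ∧-∨-elim : ∀ {x y z w} → z ∧ x ≤ w → z ∧ y ≤ w → z ∧ (x ∨ y) ≤ w
  ∧-∨-elim z∧x≤w z∧y≤w = trans (reflexive (∧-comm _ _))
    (∨-∧-elim (trans (reflexive (∧-comm _ _)) z∧x≤w) (trans (reflexive (∧-comm _ _)) z∧y≤w))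

  ∨∧∨-elim : ∀ {x y z u w} → x ∧ z ≤ w → x ∧ u ≤ w → y ∧ z ≤ w → y ∧ u ≤ w →
             (x ∨ y) ∧ (z ∨ u) ≤ w
  ∨∧∨-elim xz xu yz yu = ∨-∧-elim (∧-∨-elim xz xu) (∧-∨-elim yz yu)

  ¬-antitone : ∀ {x y} → x ≤ y → ¬ y ≤ ¬ x
  ¬-antitone = ⇨ˡ-contravariant

  ¬-cong : ∀ {x y} → x ≈ y → ¬ x ≈ ¬ y
  ¬-cong x≈y = ⇨-cong x≈y Eq.refl

  ¬¬-monotone : ∀ {x y} → x ≤ y → ¬ ¬ x ≤ ¬ ¬ y
  ¬¬-monotone = ¬-antitone ∘ ¬-antitone

  ¬¬¬x≈¬x : ∀ x → ¬ ¬ ¬ x ≈ ¬ x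
  ¬¬¬x≈¬x x = antisym (¬-antitone (x≤¬¬x x)) (x≤¬¬x (¬ x))

  x≤¬¬y⇒¬¬x≤¬¬y : ∀ {x y} → x ≤ ¬ ¬ y → ¬ ¬ x ≤ ¬ ¬ y
  x≤¬¬y⇒¬¬x≤¬¬y x≤¬¬y = trans (¬¬-monotone x≤¬¬y) (reflexive (¬¬¬x≈¬x (¬ _)))

  ¬x∧x≤⊥ : ∀ x → ¬ x ∧ x ≤ ⊥
  ¬x∧x≤⊥ x = ⇨-eval

  x∧¬x≤⊥ : ∀ x → x ∧ ¬ x ≤ ⊥
  x∧¬x≤⊥ x = trans (reflexive (∧-comm _ _)) ⇨-eval

  ¬x≤x⇨y : ∀ {x y} → ¬ x ≤ x ⇨ y
  ¬x≤x⇨y = ⇨ʳ-covariant (minimum _)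

  x∧¬y≤¬[x⇨y] : ∀ {x y} → x ∧ ¬ y ≤ ¬ (x ⇨ y)
  x∧¬y≤¬[x⇨y] {x} {y} = transpose-⇨ (begin
    (x ∧ ¬ y) ∧ (x ⇨ y) ≤⟨ ∧-greatest (trans (x∧y≤x _ _) (x∧y≤y _ _))
                                      (∧-greatest (x∧y≤y _ _) (trans (x∧y≤x _ _) (x∧y≤x _ _))) ⟩
    ¬ y ∧ (x ⇨ y) ∧ x   ≤⟨ ∧-monotonic refl ⇨-eval ⟩
    ¬ y ∧ y             ≤⟨ ¬x∧x≤⊥ y ⟩
    ⊥                   ∎)

  ¬¬-distrib-∧ : ∀ x y → ¬ ¬ (x ∧ y) ≈ ¬ ¬ x ∧ ¬ ¬ y
  ¬¬-distrib-∧ x y = begin-equality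
    ¬ ¬ (x ∧ y)         ≈⟨ ¬-cong (de-morgan₂ x y) ⟩
    ¬ ¬ ¬ (¬ x ∨ ¬ y)   ≈⟨ ¬¬¬x≈¬x _ ⟩
    ¬ (¬ x ∨ ¬ y)       ≈⟨ de-morgan₁ (¬ x) (¬ y) ⟩
    ¬ ¬ x ∧ ¬ ¬ y       ∎

  -- The reverse inequality goes through x ⇨ ¬¬y ≈ ¬(x ∧ ¬y), an instance of ⇨-curry.
  ¬¬-⇨ : ∀ x y → ¬ ¬ (x ⇨ y) ≈ x ⇨ ¬ ¬ y
  ¬¬-⇨ x y = antisym (transpose-⇨ (begin
      ¬ ¬ (x ⇨ y) ∧ x       ≤⟨ ∧-monotonic refl (x≤¬¬x x) ⟩
      ¬ ¬ (x ⇨ y) ∧ ¬ ¬ x   ≈⟨ ¬¬-distrib-∧ (x ⇨ y) x ⟨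
      ¬ ¬ ((x ⇨ y) ∧ x)     ≤⟨ ¬¬-monotone ⇨-eval ⟩
      ¬ ¬ y                 ∎))
    (swap-transpose-⇨ (begin
      ¬ (x ⇨ y) ∧ (x ⇨ ¬ ¬ y)          ≤⟨ ∧-monotonic ¬[x⇨y]≤¬¬[x∧¬y] (reflexive (Eq.sym ⇨-curry)) ⟩
      ¬ ¬ (x ∧ ¬ y) ∧ ¬ (x ∧ ¬ y)      ≤⟨ ¬x∧x≤⊥ (¬ (x ∧ ¬ y)) ⟩
      ⊥                                ∎))
    where
    ¬[x⇨y]≤¬¬[x∧¬y] : ¬ (x ⇨ y) ≤ ¬ ¬ (x ∧ ¬ y)
    ¬[x⇨y]≤¬¬[x∧¬y] = begin
      ¬ (x ⇨ y)         ≤⟨ ∧-greatest (¬-antitone ¬x≤x⇨y) (¬-antitone y≤x⇨y) ⟩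
      ¬ ¬ x ∧ ¬ y       ≈⟨ ∧-cong Eq.refl (¬¬¬x≈¬x y) ⟨
      ¬ ¬ x ∧ ¬ ¬ ¬ y   ≈⟨ ¬¬-distrib-∧ x (¬ y) ⟨
      ¬ ¬ (x ∧ ¬ y)     ∎

  Regular : Carrier → Set ℓ₁
  Regular x = ¬ ¬ x ≈ x

  ⊥-regular : Regular ⊥
  ⊥-regular = antisym (trans (∧-greatest refl (maximum _)) (⇨-applyˡ ⊤≤¬⊥)) (minimum _)
    where
    ⊤≤¬⊥ : ⊤ ≤ ¬ ⊥
    ⊤≤¬⊥ = transpose-⇨ (x∧y≤y _ _)

  ¬-regular : ∀ x → Regular (¬ x)
  ¬-regular = ¬¬¬x≈¬x

  Dense : Carrier → Set ℓ₂
  Dense x = ⊤ ≤ ¬ ¬ x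

  x∨¬x-dense : ∀ x → Dense (x ∨ ¬ x)
  x∨¬x-dense x = reflexive (Eq.sym (Eq.trans (¬-cong (¬-cong (∨-comm x (¬ x)))) weak-lem))

  ∧-dense : ∀ {x y} → Dense x → Dense y → Dense (x ∧ y)
  ∧-dense dx dy = trans (∧-greatest dx dy) (reflexive (Eq.sym (¬¬-distrib-∧ _ _)))

  ¬-dense≤⊥ : ∀ {x} → Dense x → ¬ x ≤ ⊥
  ¬-dense≤⊥ {x} dx = trans (∧-greatest (trans (maximum _) dx) refl) (¬x∧x≤⊥ (¬ x))

  ⋀ : ∀ n → (Fin n → Carrier) → Carrier
  ⋀ zero    x = ⊤
  ⋀ (suc n) x = x zero ∧ ⋀ n (x ∘ suc)

  ⋀≤ : ∀ {n} (x : Fin n → Carrier) j → ⋀ n x ≤ x j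
  ⋀≤ x zero    = x∧y≤x _ _
  ⋀≤ x (suc j) = trans (x∧y≤y _ _) (⋀≤ (x ∘ suc) j)

  ⋀-dense : ∀ {n} (x : Fin n → Carrier) → (∀ j → Dense (x j)) → Dense (⋀ n x)
  ⋀-dense {zero}  x dense = x≤¬¬x ⊤
  ⋀-dense {suc n} x dense = ∧-dense (dense zero) (⋀-dense (x ∘ suc) (dense ∘ suc))

  Decided : Carrier → Carrier → Set ℓ₂
  Decided d x = d ≤ x ∨ ¬ x

  [d∨x]∧¬¬x≈x : ∀ {d x} → Decided d x → (d ∨ x) ∧ ¬ ¬ x ≈ x
  [d∨x]∧¬¬x≈x {d} {x} d≤x∨¬x = antisym
    (∨-∧-elim (trans (∧-monotonic d≤x∨¬x refl)
                     (∨-∧-elim (x∧y≤x _ _) (trans (x∧¬x≤⊥ (¬ x)) (minimum x))))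
              (x∧y≤x _ _))
    (∧-greatest (y≤x∨y d x) (x≤¬¬x x))

  d∨[x⇨y]≈[d∨x⇨d∨y]∧[d∨¬¬[x⇨y]] : ∀ {d x y} → Decided d y →
    d ∨ (x ⇨ y) ≈ (d ∨ x ⇨ d ∨ y) ∧ (d ∨ ¬ ¬ (x ⇨ y))
  d∨[x⇨y]≈[d∨x⇨d∨y]∧[d∨¬¬[x⇨y]] {d} {x} {y} d≤y∨¬y = antisym
    (∨-least (∧-greatest (trans (x≤x∨y d y) y≤x⇨y) (x≤x∨y _ _))
             (∧-greatest x⇨y≤d∨x⇨d∨y (trans (x≤¬¬x _) (y≤x∨y _ _))))
    (∧-∨-elim (trans (x∧y≤y _ _) (x≤x∨y _ _)) (trans (transpose-⇨ recover-y) (y≤x∨y _ _)))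
    where
    x⇨y≤d∨x⇨d∨y : x ⇨ y ≤ d ∨ x ⇨ d ∨ y
    x⇨y≤d∨x⇨d∨y = transpose-⇨
      (∧-∨-elim (trans (x∧y≤y _ _) (x≤x∨y d y)) (trans ⇨-eval (y≤x∨y d y)))
    recover-y : ((d ∨ x ⇨ d ∨ y) ∧ ¬ ¬ (x ⇨ y)) ∧ x ≤ y
    recover-y = begin
      ((d ∨ x ⇨ d ∨ y) ∧ ¬ ¬ (x ⇨ y)) ∧ x
        ≤⟨ ∧-greatest (trans (∧-monotonic (x∧y≤x _ _) (y≤x∨y d x)) ⇨-eval)
                      (trans (∧-monotonic (x∧y≤y _ _) refl)
                             (transpose-∧ (reflexive (¬¬-⇨ x y)))) ⟩
      (d ∨ y) ∧ ¬ ¬ y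
        ≈⟨ [d∨x]∧¬¬x≈x d≤y∨¬y ⟩
      y ∎

  finite-from-pairs : ∀ {p m} (e : Fin p → Fin m → Carrier) →
    (∀ a → Σ (Fin p) λ i → Σ (Fin m) λ k → e i k ≈ a) → Finite A
  finite-from-pairs {p} {m} e cover = p * m , uncurry e ∘ remQuot m , λ a →
    let (i , k , eik≈a) = cover a in
    combine i k , Eq.trans (Eq.reflexive (≡.cong (uncurry e) (remQuot-combine i k))) eik≈a

module Subuniverses {c ℓ₁ ℓ₂} (A : HeytingAlgebra c ℓ₁ ℓ₂) where
  open HeytingAlgebra A
  open Properties A

  record IsSubuniverse {p} (P : Carrier → Set p) : Set (c ⊔ p) where
    field
      ⊥-closed : P ⊥
      ⊤-closed : P ⊤
      ∧-closed : ∀ {x y} → P x → P y → P (x ∧ y)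
      ∨-closed : ∀ {x y} → P x → P y → P (x ∨ y)
      ⇨-closed : ∀ {x y} → P x → P y → P (x ⇨ y)

  ⟦⟧-closed : ∀ {p} {P : Carrier → Set p} → IsSubuniverse P →
              ∀ {X} {ρ : X → Carrier} → (∀ x → P (ρ x)) → ∀ t → P (⟦ A ⟧ t ρ)
  ⟦⟧-closed sub Pρ (var x)  = Pρ x
  ⟦⟧-closed sub Pρ zer      = IsSubuniverse.⊥-closed sub
  ⟦⟧-closed sub Pρ one      = IsSubuniverse.⊤-closed sub
  ⟦⟧-closed sub Pρ (s ∧ₜ t) = IsSubuniverse.∧-closed sub (⟦⟧-closed sub Pρ s) (⟦⟧-closed sub Pρ t)
  ⟦⟧-closed sub Pρ (s ∨ₜ t) = IsSubuniverse.∨-closed sub (⟦⟧-closed sub Pρ s) (⟦⟧-closed sub Pρ t)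
  ⟦⟧-closed sub Pρ (s ⇒ₜ t) = IsSubuniverse.⇨-closed sub (⟦⟧-closed sub Pρ s) (⟦⟧-closed sub Pρ t)
  ⟦⟧-closed sub Pρ (¬ₜ s)   = IsSubuniverse.⇨-closed sub (⟦⟧-closed sub Pρ s) (IsSubuniverse.⊥-closed sub)

  decided-subuniverse : ∀ d → IsSubuniverse (Decided d)
  decided-subuniverse d = record
    { ⊥-closed = trans (maximum d) (trans (transpose-⇨ (x∧y≤y _ _)) (y≤x∨y _ _))
    ; ⊤-closed = trans (maximum d) (x≤x∨y _ _)
    ; ∧-closed = λ dx dy → trans (∧-greatest dx dy) (∨∧∨-elim
        (x≤x∨y _ _)
        (trans (x∧y≤y _ _) (trans (¬-antitone (x∧y≤y _ _)) (y≤x∨y _ _)))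
        (trans (x∧y≤x _ _) (trans (¬-antitone (x∧y≤x _ _)) (y≤x∨y _ _)))
        (trans (x∧y≤x _ _) (trans (¬-antitone (x∧y≤x _ _)) (y≤x∨y _ _))))
    ; ∨-closed = λ dx dy → trans (∧-greatest dx dy) (∨∧∨-elim
        (trans (x∧y≤x _ _) (trans (x≤x∨y _ _) (x≤x∨y _ _)))
        (trans (x∧y≤x _ _) (trans (x≤x∨y _ _) (x≤x∨y _ _)))
        (trans (x∧y≤y _ _) (trans (y≤x∨y _ _) (x≤x∨y _ _)))
        (trans (reflexive (Eq.sym (de-morgan₁ _ _))) (y≤x∨y _ _)))
    ; ⇨-closed = λ dx dy → trans (∧-greatest dx dy) (∨∧∨-elim
        (trans (x∧y≤y _ _) (trans y≤x⇨y (x≤x∨y _ _)))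
        (trans x∧¬y≤¬[x⇨y] (y≤x∨y _ _))
        (trans (x∧y≤y _ _) (trans y≤x⇨y (x≤x∨y _ _)))
        (trans (x∧y≤x _ _) (trans ¬x≤x⇨y (x≤x∨y _ _))))
    }

  ZeroOrAbove : Carrier → Carrier → Set ℓ₂
  ZeroOrAbove d x = x ≤ ⊥ ⊎ d ≤ x

  zeroOrAbove-subuniverse : ∀ {d} → Dense d → IsSubuniverse (ZeroOrAbove d)
  zeroOrAbove-subuniverse {d} d-dense = record
    { ⊥-closed = inj₁ refl
    ; ⊤-closed = inj₂ (maximum d)
    ; ∧-closed = ∧-closed
    ; ∨-closed = ∨-closed
    ; ⇨-closed = ⇨-closed
    }
    where
    ∧-closed : ∀ {x y} → ZeroOrAbove d x → ZeroOrAbove d y → ZeroOrAbove d (x ∧ y)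
    ∧-closed (inj₁ x≤⊥) _          = inj₁ (trans (x∧y≤x _ _) x≤⊥)
    ∧-closed (inj₂ d≤x) (inj₁ y≤⊥) = inj₁ (trans (x∧y≤y _ _) y≤⊥)
    ∧-closed (inj₂ d≤x) (inj₂ d≤y) = inj₂ (∧-greatest d≤x d≤y)
    ∨-closed : ∀ {x y} → ZeroOrAbove d x → ZeroOrAbove d y → ZeroOrAbove d (x ∨ y)
    ∨-closed (inj₁ x≤⊥) (inj₁ y≤⊥) = inj₁ (∨-least x≤⊥ y≤⊥)
    ∨-closed (inj₁ x≤⊥) (inj₂ d≤y) = inj₂ (trans d≤y (y≤x∨y _ _))
    ∨-closed (inj₂ d≤x) _          = inj₂ (trans d≤x (x≤x∨y _ _))
    ⇨-closed : ∀ {x y} → ZeroOrAbove d x → ZeroOrAbove d y → ZeroOrAbove d (x ⇨ y)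
    ⇨-closed (inj₁ x≤⊥) _          = inj₂ (transpose-⇨ (trans (x∧y≤y _ _) (trans x≤⊥ (minimum _))))
    ⇨-closed (inj₂ d≤x) (inj₁ y≤⊥) = inj₁ (trans (⇨-relax d≤x y≤⊥) (¬-dense≤⊥ d-dense))
    ⇨-closed (inj₂ d≤x) (inj₂ d≤y) = inj₂ (trans d≤y y≤x⇨y)

  zeroOrAbove⇒¬x∨¬¬x≈⊤ : ∀ {d x} → Dense d → ZeroOrAbove d x → ¬ x ∨ ¬ ¬ x ≈ ⊤
  zeroOrAbove⇒¬x∨¬¬x≈⊤ d-dense (inj₁ x≤⊥) = antisym (maximum _)
    (trans (transpose-⇨ (trans (x∧y≤y _ _) x≤⊥)) (x≤x∨y _ _))
  zeroOrAbove⇒¬x∨¬¬x≈⊤ d-dense (inj₂ d≤x) = antisym (maximum _)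
    (trans (transpose-⇨ (trans (x∧y≤y _ _) (trans (¬-antitone d≤x) (¬-dense≤⊥ d-dense))))
           (y≤x∨y _ _))

module _ {a₁ a₂ a₃ b₁ b₂ b₃} (A : HeytingAlgebra a₁ a₂ a₃) (B : HeytingAlgebra b₁ b₂ b₃) where
  private
    module A = HeytingAlgebra A
    module B = HeytingAlgebra B

  record IsHomomorphism (h : A.Carrier → B.Carrier) : Set (a₁ ⊔ a₂ ⊔ b₂) where
    field
      cong   : ∀ {x y} → x A.≈ y → h x B.≈ h y
      ∧-homo : ∀ x y → h (x A.∧ y) B.≈ h x B.∧ h y
      ∨-homo : ∀ x y → h (x A.∨ y) B.≈ h x B.∨ h y
      ⇨-homo : ∀ x y → h (x A.⇨ y) B.≈ h x B.⇨ h y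
      ⊤-homo : h A.⊤ B.≈ B.⊤
      ⊥-homo : h A.⊥ B.≈ B.⊥

module Homomorphism {a₁ a₂ a₃ b₁ b₂ b₃}
  {A : HeytingAlgebra a₁ a₂ a₃} {B : HeytingAlgebra b₁ b₂ b₃}
  {h : HeytingAlgebra.Carrier A → HeytingAlgebra.Carrier B} (hom : IsHomomorphism A B h) where
  private
    module A = HeytingAlgebra A
    module B = HeytingAlgebra B
  open IsHomomorphism hom
  open Properties B using (∧-cong; ∨-cong; ⇨-cong)
  open ≈-Reasoning B.setoid

  ⟦⟧-homo : ∀ {X} {ρ : X → A.Carrier} {σ : X → B.Carrier} →
            (∀ x → h (ρ x) B.≈ σ x) → ∀ t → h (⟦ A ⟧ t ρ) B.≈ ⟦ B ⟧ t σ
  ⟦⟧-homo hρ≈σ (var x)  = hρ≈σ x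
  ⟦⟧-homo hρ≈σ zer      = ⊥-homo
  ⟦⟧-homo hρ≈σ one      = ⊤-homo
  ⟦⟧-homo hρ≈σ (s ∧ₜ t) = B.Eq.trans (∧-homo _ _) (∧-cong (⟦⟧-homo hρ≈σ s) (⟦⟧-homo hρ≈σ t))
  ⟦⟧-homo hρ≈σ (s ∨ₜ t) = B.Eq.trans (∨-homo _ _) (∨-cong (⟦⟧-homo hρ≈σ s) (⟦⟧-homo hρ≈σ t))
  ⟦⟧-homo hρ≈σ (s ⇒ₜ t) = B.Eq.trans (⇨-homo _ _) (⇨-cong (⟦⟧-homo hρ≈σ s) (⟦⟧-homo hρ≈σ t))
  ⟦⟧-homo hρ≈σ (¬ₜ s)   = B.Eq.trans (⇨-homo _ _) (⇨-cong (⟦⟧-homo hρ≈σ s) ⊥-homo)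

  module Surjective (section : B.Carrier → A.Carrier) (h∘section≈id : ∀ b → h (section b) B.≈ b) where

    image-⊨ : ∀ e → A ⊨ e → B ⊨ e
    image-⊨ (l , r) A⊨l≈r ρ = begin
      ⟦ B ⟧ l ρ                 ≈⟨ ⟦⟧-homo (h∘section≈id ∘ ρ) l ⟨
      h (⟦ A ⟧ l (section ∘ ρ)) ≈⟨ cong (A⊨l≈r (section ∘ ρ)) ⟩
      h (⟦ A ⟧ r (section ∘ ρ)) ≈⟨ ⟦⟧-homo (h∘section≈id ∘ ρ) r ⟩
      ⟦ B ⟧ r ρ                 ∎

    image-fg : FinitelyGenerated A → FinitelyGenerated B
    image-fg (n , g , generates) = n , h ∘ g , λ b →
      let (t , t≈section-b) = generates (section b) in
      t , (begin
        ⟦ B ⟧ t (h ∘ g)  ≈⟨ ⟦⟧-homo (λ _ → B.Eq.refl) t ⟨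
        h (⟦ A ⟧ t g)    ≈⟨ cong t≈section-b ⟩
        h (section b)    ≈⟨ h∘section≈id b ⟩
        b                ∎)

  module Embedding (h-reflects-≈ : ∀ {x y} → h x B.≈ h y → x A.≈ y) where

    embedding-⊨ : ∀ e → B ⊨ e → A ⊨ e
    embedding-⊨ (l , r) B⊨l≈r ρ = h-reflects-≈ (begin
      h (⟦ A ⟧ l ρ)    ≈⟨ ⟦⟧-homo (λ _ → B.Eq.refl) l ⟩
      ⟦ B ⟧ l (h ∘ ρ)  ≈⟨ B⊨l≈r (h ∘ ρ) ⟩
      ⟦ B ⟧ r (h ∘ ρ)  ≈⟨ ⟦⟧-homo (λ _ → B.Eq.refl) r ⟨
      h (⟦ A ⟧ r ρ)    ∎)

∈V′ : ∀ {c ℓ₁ ℓ₂} {A : HeytingAlgebra c ℓ₁ ℓ₂} {V : Variety} →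
      A ∈V V → A ⊨ kcEquation → A ∈V (V ′)
∈V′ A∈V A⊨kc e (inj₁ e∈V)    = A∈V e e∈V
∈V′ A∈V A⊨kc e (inj₂ ≡.refl) = A⊨kc

-- A/~ for x ~ y ⇔ ¬¬x ≈ ¬¬y, i.e. the Boolean algebra of regular elements of A.
module DoubleNegation {c ℓ₁ ℓ₂} (A : HeytingAlgebra c ℓ₁ ℓ₂) where
  open HeytingAlgebra A
  open Properties A

  quotient : HeytingAlgebra c ℓ₁ ℓ₂
  quotient = record
    { Carrier = Carrier
    ; _≈_ = λ x y → ¬ ¬ x ≈ ¬ ¬ y
    ; _≤_ = λ x y → x ≤ ¬ ¬ y
    ; _∨_ = _∨_ ; _∧_ = _∧_ ; _⇨_ = _⇨_ ; ⊤ = ⊤ ; ⊥ = ⊥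
    ; isHeytingAlgebra = record
      { isBoundedLattice = record
        { isLattice = record
          { isPartialOrder = record
            { isPreorder = record
              { isEquivalence = record { refl = Eq.refl ; sym = Eq.sym ; trans = Eq.trans }
              ; reflexive = λ ¬¬x≈¬¬y → trans (x≤¬¬x _) (reflexive ¬¬x≈¬¬y)
              ; trans = λ x≤¬¬y y≤¬¬z → trans x≤¬¬y (x≤¬¬y⇒¬¬x≤¬¬y y≤¬¬z)
              }
            ; antisym = λ x≤¬¬y y≤¬¬x → antisym (x≤¬¬y⇒¬¬x≤¬¬y x≤¬¬y) (x≤¬¬y⇒¬¬x≤¬¬y y≤¬¬x)
            }
          ; supremum = λ x y →
              trans (x≤x∨y x y) (x≤¬¬x _) , trans (y≤x∨y x y) (x≤¬¬x _) , λ z → ∨-least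
          ; infimum = λ x y →
              trans (x∧y≤x x y) (x≤¬¬x _) , trans (x∧y≤y x y) (x≤¬¬x _) ,
              λ z z≤¬¬x z≤¬¬y → trans (∧-greatest z≤¬¬x z≤¬¬y) (reflexive (Eq.sym (¬¬-distrib-∧ x y)))
          }
        ; maximum = λ x → trans (maximum x) (x≤¬¬x ⊤)
        ; minimum = λ x → minimum (¬ ¬ x)
        }
      ; exponential = λ w x y →
          (λ w∧x≤¬¬y → trans (transpose-⇨ w∧x≤¬¬y) (reflexive (Eq.sym (¬¬-⇨ x y)))) ,
          (λ w≤¬¬[x⇨y] → transpose-∧ (trans w≤¬¬[x⇨y] (reflexive (¬¬-⇨ x y))))
      }
    }

  private
    module Q = HeytingAlgebra quotient

  quotient-map-homo : IsHomomorphism A quotient (λ x → x)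
  quotient-map-homo = record
    { cong   = λ x≈y → ¬-cong (¬-cong x≈y)
    ; ∧-homo = λ _ _ → Eq.refl
    ; ∨-homo = λ _ _ → Eq.refl
    ; ⇨-homo = λ _ _ → Eq.refl
    ; ⊤-homo = Eq.refl
    ; ⊥-homo = Eq.refl
    }

  open Homomorphism.Surjective quotient-map-homo (λ x → x) (λ _ → Eq.refl)
    renaming (image-fg to quotient-fg)
    public

  quotient-excluded-middle : ∀ x → x Q.∨ (x Q.⇨ Q.⊥) Q.≈ Q.⊤
  quotient-excluded-middle x = Q.antisym (Q.maximum _) (x∨¬x-dense x)

  quotient-∈V′ : ∀ {V} → A ∈V V → quotient ∈V (V ′)
  quotient-∈V′ A∈V = ∈V′ {A = quotient} (λ e e∈V → image-⊨ e (A∈V e e∈V)) (λ ρ → quotient-excluded-middle (¬ ρ 0))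

module Generated {c ℓ₁ ℓ₂} (A : HeytingAlgebra c ℓ₁ ℓ₂) {n} (γ : Fin n → HeytingAlgebra.Carrier A) where
  open HeytingAlgebra A
  open Subuniverses A using (IsSubuniverse; ⟦⟧-closed)

  value : Lift c (Term (Fin n)) → Carrier
  value s = ⟦ A ⟧ (lower s) γ

  subalgebra : HeytingAlgebra c ℓ₁ ℓ₂
  subalgebra = record
    { Carrier = Lift c (Term (Fin n))
    ; _≈_ = λ s t → value s ≈ value t
    ; _≤_ = λ s t → value s ≤ value t
    ; _∨_ = λ s t → lift (lower s ∨ₜ lower t)
    ; _∧_ = λ s t → lift (lower s ∧ₜ lower t)
    ; _⇨_ = λ s t → lift (lower s ⇒ₜ lower t)
    ; ⊤ = lift one
    ; ⊥ = lift zer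
    ; isHeytingAlgebra = record
      { isBoundedLattice = record
        { isLattice = record
          { isPartialOrder = record
            { isPreorder = record
              { isEquivalence = record { refl = Eq.refl ; sym = Eq.sym ; trans = Eq.trans }
              ; reflexive = reflexive
              ; trans = trans
              }
            ; antisym = antisym
            }
          ; supremum = λ s t → x≤x∨y _ _ , y≤x∨y _ _ , λ _ → ∨-least
          ; infimum = λ s t → x∧y≤x _ _ , x∧y≤y _ _ , λ _ → ∧-greatest
          }
        ; maximum = λ _ → maximum _
        ; minimum = λ _ → minimum _
        }
      ; exponential = λ _ _ _ → transpose-⇨ , transpose-∧
      }
    }

  value-homo : IsHomomorphism subalgebra A value
  value-homo = record
    { cong   = λ s≈t → s≈t
    ; ∧-homo = λ _ _ → Eq.refl
    ; ∨-homo = λ _ _ → Eq.refl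
    ; ⇨-homo = λ _ _ → Eq.refl
    ; ⊤-homo = Eq.refl
    ; ⊥-homo = Eq.refl
    }

  open Homomorphism.Embedding value-homo (λ s≈t → s≈t) public

  subalgebra-fg : FinitelyGenerated subalgebra
  subalgebra-fg = n , lift ∘ var , λ s →
    lower s , Homomorphism.⟦⟧-homo value-homo (λ _ → Eq.refl) (lower s)

  value-closed : ∀ {p} {P : Carrier → Set p} → IsSubuniverse P →
                 (∀ i → P (γ i)) → ∀ s → P (value s)
  value-closed P-closed Pγ s = ⟦⟧-closed P-closed Pγ (lower s)

module Decomposition {c ℓ₁ ℓ₂} (A : HeytingAlgebra c ℓ₁ ℓ₂) {n} (g : Fin n → HeytingAlgebra.Carrier A)
  (quotient-finite : Finite (DoubleNegation.quotient A)) where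
  open HeytingAlgebra A
  open Properties A
  open Subuniverses A

  m : ℕ
  m = proj₁ quotient-finite

  regular : Fin m → Carrier
  regular k = ¬ ¬ proj₁ (proj₂ quotient-finite) k

  index : Carrier → Fin m
  index a = proj₁ (proj₂ (proj₂ quotient-finite) a)

  regular-index : ∀ a → regular (index a) ≈ ¬ ¬ a
  regular-index a = proj₂ (proj₂ (proj₂ quotient-finite) a)

  d : Carrier
  d = ⋀ n (λ j → g j ∨ ¬ g j)

  d-dense : Dense d
  d-dense = ⋀-dense _ (λ j → x∨¬x-dense (g j))

  term-decided : ∀ t → Decided d (⟦ A ⟧ t g)
  term-decided = ⟦⟧-closed (decided-subuniverse d) (⋀≤ _)

  generator : Fin n ⊎ Fin m → Carrier
  generator (inj₁ j) = d ∨ g j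
  generator (inj₂ k) = d ∨ regular k

  generators : Fin (n + m) → Carrier
  generators = generator ∘ splitAt n

  module K = Generated A generators

  generator-zeroOrAbove : ∀ i → ZeroOrAbove d (generator i)
  generator-zeroOrAbove (inj₁ j) = inj₂ (x≤x∨y _ _)
  generator-zeroOrAbove (inj₂ k) = inj₂ (x≤x∨y _ _)

  subalgebra-∈V′ : ∀ {V} → A ∈V V → K.subalgebra ∈V (V ′)
  subalgebra-∈V′ A∈V = ∈V′ {A = K.subalgebra} (λ e e∈V → K.embedding-⊨ e (A∈V e e∈V))
    (λ ρ → zeroOrAbove⇒¬x∨¬¬x≈⊤ d-dense
             (K.value-closed (zeroOrAbove-subuniverse d-dense) (generator-zeroOrAbove ∘ splitAt n) (ρ 0)))

  regular-var : Carrier → Term (Fin (n + m))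
  regular-var x = var (n ↑ʳ index x)

  regular-var-value : ∀ {x} → Regular x → ⟦ A ⟧ (regular-var x) generators ≈ d ∨ x
  regular-var-value {x} x-regular = Eq.trans
    (Eq.reflexive (≡.cong generator (splitAt-↑ʳ n m (index x))))
    (∨-cong Eq.refl (Eq.trans (regular-index x) x-regular))

  d∨-term : Term (Fin n) → Term (Fin (n + m))
  d∨-term (var j)  = var (j ↑ˡ m)
  d∨-term zer      = regular-var ⊥
  d∨-term one      = one
  d∨-term (s ∧ₜ t) = d∨-term s ∧ₜ d∨-term t
  d∨-term (s ∨ₜ t) = d∨-term s ∨ₜ d∨-term t
  d∨-term (s ⇒ₜ t) = (d∨-term s ⇒ₜ d∨-term t) ∧ₜ regular-var (¬ ¬ (⟦ A ⟧ s g ⇨ ⟦ A ⟧ t g))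
  d∨-term (¬ₜ s)   = regular-var (¬ ⟦ A ⟧ s g)

  d∨-term-value : ∀ t → ⟦ A ⟧ (d∨-term t) generators ≈ d ∨ ⟦ A ⟧ t g
  d∨-term-value (var j)  = Eq.reflexive (≡.cong generator (splitAt-↑ˡ n j m))
  d∨-term-value zer      = regular-var-value ⊥-regular
  d∨-term-value one      = Eq.sym (∨-zeroʳ d)
  d∨-term-value (s ∧ₜ t) = Eq.trans (∧-cong (d∨-term-value s) (d∨-term-value t))
                                    (Eq.sym (∨-distribˡ-∧ d _ _))
  d∨-term-value (s ∨ₜ t) = Eq.trans (∨-cong (d∨-term-value s) (d∨-term-value t))
                                    (Eq.sym (∨-distribˡ-∨ d _ _))
  d∨-term-value (s ⇒ₜ t) = Eq.trans (∧-cong (⇨-cong (d∨-term-value s) (d∨-term-value t))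
                                            (regular-var-value (¬-regular _)))
                                    (Eq.sym (d∨[x⇨y]≈[d∨x⇨d∨y]∧[d∨¬¬[x⇨y]] (term-decided t)))
  d∨-term-value (¬ₜ s)   = regular-var-value (¬-regular _)

  A-finite : Finite K.subalgebra → (∀ a → Σ (Term (Fin n)) λ t → ⟦ A ⟧ t g ≈ a) → Finite A
  A-finite (p , e , e-covers) generates =
    finite-from-pairs (λ i k → K.value (e i) ∧ regular k) λ a →
      let (t , t≈a) = generates a
          (i , eᵢ≈d∨t) = e-covers (lift (d∨-term t))
      in i , index a , (begin
        K.value (e i) ∧ regular (index a)
          ≈⟨ ∧-cong (Eq.trans eᵢ≈d∨t (d∨-term-value t))
                    (Eq.trans (regular-index a) (¬-cong (¬-cong (Eq.sym t≈a)))) ⟩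
        (d ∨ ⟦ A ⟧ t g) ∧ ¬ ¬ ⟦ A ⟧ t g
          ≈⟨ [d∨x]∧¬¬x≈x (term-decided t) ⟩
        ⟦ A ⟧ t g
          ≈⟨ t≈a ⟩
        a ∎)
    where open ≈-Reasoning setoid

theorem8 : ∀ {c ℓ₁ ℓ₂ : Level} (V : Variety) →
             LocallyFinite c ℓ₁ ℓ₂ V ⇔ LocallyFinite c ℓ₁ ℓ₂ (V ′)
theorem8 {c} {ℓ₁} {ℓ₂} V = mk⇔ restrict extend
  where
  restrict : LocallyFinite c ℓ₁ ℓ₂ V → LocallyFinite c ℓ₁ ℓ₂ (V ′)
  restrict V-lf A A∈V′ = V-lf A (λ e → A∈V′ e ∘ inj₁)

  extend : LocallyFinite c ℓ₁ ℓ₂ (V ′) → LocallyFinite c ℓ₁ ℓ₂ V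
  extend V′-lf A A∈V A-fg@(n , g , generates) =
    A-finite (V′-lf K.subalgebra (subalgebra-∈V′ A∈V) K.subalgebra-fg) generates
    where
    open DoubleNegation A using (quotient; quotient-∈V′; quotient-fg)
    quotient-finite : Finite quotient
    quotient-finite = V′-lf quotient (quotient-∈V′ A∈V) (quotient-fg A-fg)
    open Decomposition A g quotient-finite
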